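{- For any finite connected non-complete graph $G$ with at least one edge, there exists a Grundy dominating sequence $S$ of $G$ such that the subgraph of $G$ induced by the set $\widehat{S}$ of vertices of $S$ contains no isolated vertices.
   Context: For a graph $G$, a sequence of vertices $S=(v_1,\dots,v_k)$ is a legal sequence if for every $i\in[k]$, $N[v_i]\setminus\bigcup_{j=1}^{i-1}N[v_j]\neq\emptyset$ ($N[v]$ the closed neighborhood). A Grundy dominating sequence is a legal sequence of maximum length, and $\widehat{S}=\{v_1,\dots,v_k\}$ denotes the set of its vertices. -}

module Defs where

open import Data.Nat using (ℕ; _≤_)
open import Data.Fin using (Fin)
open import Data.List using (List; []; _∷_; length)
open import Data.List.Membership.Propositional using (_∈_)
open import Data.List.Relation.Unary.All using (All)
open import Data.Product using (Σ; ∃; ∃-syntax; _×_)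
open import Data.Sum using (_⊎_)
open import Relation.Nullary using (¬_; Dec)
open import Relation.Binary.PropositionalEquality using (_≡_)

record Graph (n : ℕ) : Set₁ where
  field
    Adj   : Fin n → Fin n → Set
    sym   : ∀ {u v} → Adj u v → Adj v u
    irrefl : ∀ {u} → ¬ Adj u u
    adj?   : ∀ u v → Dec (Adj u v)
open Graph public

_∈N[_]_ : ∀ {n} → Fin n → Graph n → Fin n → Set
u ∈N[ G ] v = u ≡ v ⊎ Adj G v u

NotDominatedBy : ∀ {n} → Graph n → List (Fin n) → Fin n → Set
NotDominatedBy G prev u = All (λ w → ¬ (u ∈N[ G ] w)) prev

-- Legality, with the list written in REVERSE order: (v ∷ prev) is legal iff
-- prev is legal and N[v] \ ⋃_{w ∈ prev} N[w] ≠ ∅.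
LegalRev : ∀ {n} → Graph n → List (Fin n) → Set
LegalRev G [] = Data.Unit.⊤
  where import Data.Unit
LegalRev G (v ∷ prev) = LegalRev G prev × ∃[ u ] (u ∈N[ G ] v × NotDominatedBy G prev u)

Legal : ∀ {n} → Graph n → List (Fin n) → Set
Legal G S = LegalRev G (Data.List.reverse S)
  where import Data.List

GrundyDominating : ∀ {n} → Graph n → List (Fin n) → Set
GrundyDominating G S = Legal G S × (∀ T → Legal G T → length T ≤ length S)

data Walk {n} (G : Graph n) : Fin n → Fin n → Set where
  here  : ∀ {u} → Walk G u u
  step  : ∀ {u v w} → Adj G u v → Walk G v w → Walk G u w

Connected : ∀ {n} → Graph n → Set
Connected G = ∀ u v → Walk G u v

NonComplete : ∀ {n} → Graph n → Set
NonComplete G = ∃[ u ] ∃[ v ] (¬ u ≡ v × ¬ Adj G u v)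

HasEdge : ∀ {n} → Graph n → Set
HasEdge G = ∃[ u ] ∃[ v ] Adj G u v

InducedNoIsolated : ∀ {n} → Graph n → List (Fin n) → Set
InducedNoIsolated G S = ∀ {v} → v ∈ S → ∃[ w ] (w ∈ S × Adj G v w)

-- Among Grundy dominating sequences take one with the fewest vertices isolated in the
-- induced subgraph, and suppose v is such a vertex.  Deleting v leaves a legal sequence R
-- that does not dominate v, and maximality forbids extending R by two more vertices.
-- If some neighbour z of v has a neighbour in R, then R,z (with footprint v) is again a
-- Grundy dominating sequence.  Otherwise N(v) is a clique (else R,z,v would be legal for
-- two non-adjacent neighbours z, u of v), so, G being connected and not complete, some
-- neighbour y of v has a neighbour x outside N[v].  Then R,v,y would be legal unless x is
-- dominated by R; hence x has a neighbour in R, and R,x (with footprint y) is Grundy.  In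
-- both cases the new vertex has a neighbour in R, so fewer vertices are isolated.
module Submission where

open import Defs
open import Data.Nat using (ℕ; zero; suc; _≤_; _<_; _+_; z≤n; s≤s)
open import Data.Nat.Properties
  using (≤-pred; m≤n⇒m≤1+n; m<n⇒m<1+n; m≤n⇒m<n∨m≡n; 1+n≰n; +-suc; +-monoʳ-≤; m≤m+n; ≤-trans; module ≤-Reasoning)
open import Data.Nat.Induction using (<-wellFounded)
open import Induction.WellFounded using (Acc; acc)
open import Data.Fin using (Fin)
open import Data.Fin.Properties using (any?) renaming (_≟_ to _≟ᶠ_)
open import Data.List using (List; []; _∷_; _++_; [_]; length; reverse; allFin)
open import Data.List.Properties using (length-reverse; reverse-involutive; length-tabulate)
open import Data.List.Relation.Unary.Any using (Any; here; there) renaming (any? to anyᴸ?)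
open import Data.List.Relation.Unary.Any.Properties using (reverse⁺; reverse⁻)
open import Data.List.Relation.Unary.All as All using (All; []; _∷_; all?)
open import Data.List.Relation.Unary.All.Properties using (¬All⇒Any¬; ¬Any⇒All¬; ++⁺; ++⁻)
open import Data.List.Membership.Propositional using (_∈_; _∉_; find; lose)
open import Data.List.Membership.Propositional.Properties using (∈-allFin; ∈-∃++; ∈-++⁺ʳ)
open import Data.List.Relation.Binary.Permutation.Propositional using (_↭_; ↭-sym)
open import Data.List.Relation.Binary.Permutation.Propositional.Properties
  using (shift; ↭-length; Any-resp-↭; ∈-resp-↭)
open import Data.Product using (∃; ∃-syntax; _×_; _,_)
open import Data.Sum using (inj₁; inj₂)
import Data.Sum as Sum
open import Data.Empty using (⊥-elim)
open import Data.Unit using (tt)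
open import Function using (_∘_)
open import Relation.Nullary using (¬_; Dec; yes; no; contradiction)
open import Relation.Nullary.Decidable using (¬?; _×-dec_; _⊎-dec_; decidable-stable)
open import Relation.Unary using (Decidable)
open import Relation.Binary.PropositionalEquality using (_≡_; refl; subst)
import Relation.Binary.PropositionalEquality as ≡

count : {A : Set} {P : A → Set} → Decidable P → List A → ℕ
count P? [] = 0
count P? (x ∷ xs) with P? x
... | yes _ = suc (count P? xs)
... | no  _ = count P? xs

count≤length : {A : Set} {P : A → Set} (P? : Decidable P) (xs : List A) → count P? xs ≤ length xs
count≤length P? [] = z≤n
count≤length P? (x ∷ xs) with P? x
... | yes _ = s≤s (count≤length P? xs)
... | no  _ = m≤n⇒m≤1+n (count≤length P? xs)

module _ {A : Set} {P Q : A → Set} (P? : Decidable P) (Q? : Decidable Q) (P⇒Q : ∀ {x} → P x → Q x) where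

  count-mono : ∀ xs → count P? xs ≤ count Q? xs
  count-mono [] = z≤n
  count-mono (x ∷ xs) with P? x | Q? x
  ... | yes _  | yes _  = s≤s (count-mono xs)
  ... | yes px | no ¬qx = contradiction (P⇒Q px) ¬qx
  ... | no  _  | yes _  = m≤n⇒m≤1+n (count-mono xs)
  ... | no  _  | no  _  = count-mono xs

  count-< : ∀ {y xs} → y ∈ xs → Q y → ¬ P y → count P? xs < count Q? xs
  count-< {xs = x ∷ xs} (here refl) qy ¬py with P? x | Q? x
  ... | yes py | _      = contradiction py ¬py
  ... | no  _  | yes _  = s≤s (count-mono xs)
  ... | no  _  | no ¬qy = contradiction qy ¬qy
  count-< {xs = x ∷ xs} (there y∈xs) qy ¬py with P? x | Q? x
  ... | yes _  | yes _  = s≤s (count-< y∈xs qy ¬py)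
  ... | yes px | no ¬qx = contradiction (P⇒Q px) ¬qx
  ... | no  _  | yes _  = m<n⇒m<1+n (count-< y∈xs qy ¬py)
  ... | no  _  | no  _  = count-< y∈xs qy ¬py

Longest : {A : Set} → (List A → Set) → List A → Set
Longest P L = P L × (∀ K → P K → length K ≤ length L)

module _ {n : ℕ} where

  ∃-ofLength? : {P : List (Fin n) → Set} → Decidable P → ∀ k → Dec (∃[ L ] (length L ≡ k × P L))
  ∃-ofLength? P? zero with P? []
  ... | yes p = yes ([] , refl , p)
  ... | no ¬p = no λ { ([] , _ , p) → ¬p p }
  ∃-ofLength? P? (suc k) with any? (λ x → ∃-ofLength? (λ L → P? (x ∷ L)) k)
  ... | yes (x , L , refl , p) = yes (x ∷ L , refl , p)
  ... | no ¬p = no λ { (x ∷ L , refl , p) → ¬p (x , L , refl , p) }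

  longest-exists : ∀ {P : List (Fin n) → Set} {b} → Decidable P → P [] → (∀ K → P K → length K ≤ b)
    → ∃ (Longest P)
  longest-exists {P} {b} P? P[] bounded with longest-upTo b
    where
    longest-upTo : ∀ m → ∃[ L ] (P L × ∀ K → P K → length K ≤ m → length K ≤ length L)
    longest-upTo zero = [] , P[] , λ _ _ K≤0 → K≤0
    longest-upTo (suc m) with ∃-ofLength? P? (suc m)
    ... | yes (L , L≡ , pL) = L , pL , λ K _ K≤ → subst (length K ≤_) (≡.sym L≡) K≤
    ... | no none with L , pL , max ← longest-upTo m =
      L , pL , λ K pK K≤ →
        Sum.[ (λ K< → max K pK (≤-pred K<)) , (λ K≡ → contradiction (K , K≡ , pK) none) ] (m≤n⇒m<n∨m≡n K≤)
  ... | L , pL , max = L , pL , λ K pK → max K pK (bounded K pK)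

module _ {n : ℕ} (G : Graph n) where

  _∈N?_ : ∀ u v → Dec (u ∈N[ G ] v)
  u ∈N? v = (u ≟ᶠ v) ⊎-dec adj? G v u

  notDominated? : ∀ prev → Decidable (NotDominatedBy G prev)
  notDominated? prev u = all? (λ w → ¬? (u ∈N? w)) prev

  legalRev? : Decidable (LegalRev G)
  legalRev? [] = yes tt
  legalRev? (v ∷ prev) = legalRev? prev ×-dec any? (λ u → (u ∈N? v) ×-dec notDominated? prev u)

  -- Every step of a legal sequence dominates a further vertex.
  legalRev-length+undominated≤ : ∀ L → LegalRev G L → length L + count (notDominated? L) (allFin n) ≤ n
  legalRev-length+undominated≤ [] _ = subst (count (notDominated? []) (allFin n) ≤_) (length-tabulate (λ x → x))
    (count≤length (notDominated? []) (allFin n))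
  legalRev-length+undominated≤ (v ∷ L) (legal , u , u∈N[v] , u-free) = begin
    suc (length L) + count (notDominated? (v ∷ L)) (allFin n)   ≡⟨ ≡.sym (+-suc (length L) _) ⟩
    length L + suc (count (notDominated? (v ∷ L)) (allFin n))   ≤⟨ +-monoʳ-≤ (length L) fewer ⟩
    length L + count (notDominated? L) (allFin n)               ≤⟨ legalRev-length+undominated≤ L legal ⟩
    n                                                           ∎
    where
    open ≤-Reasoning
    fewer : count (notDominated? (v ∷ L)) (allFin n) < count (notDominated? L) (allFin n)
    fewer = count-< (notDominated? (v ∷ L)) (notDominated? L) All.tail
              (∈-allFin u) u-free (λ u-free′ → All.head u-free′ u∈N[v])

  legalRev-length≤ : ∀ L → LegalRev G L → length L ≤ n
  legalRev-length≤ L legal = ≤-trans (m≤m+n (length L) _) (legalRev-length+undominated≤ L legal)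

  legalRev-head∉ : ∀ {v R} → LegalRev G (v ∷ R) → v ∉ R
  legalRev-head∉ (_ , u , u∈N[v] , u-free) v∈R = All.lookup u-free v∈R u∈N[v]

  legalRev-∉-removed : ∀ xs {v} ys → LegalRev G (xs ++ v ∷ ys) → v ∉ xs ++ ys
  legalRev-∉-removed []       ys legal              = legalRev-head∉ legal
  legalRev-∉-removed (x ∷ xs) ys legal (here refl)  = legalRev-head∉ legal (∈-++⁺ʳ xs (here refl))
  legalRev-∉-removed (x ∷ xs) ys (legal , _) (there v∈) = legalRev-∉-removed xs ys legal v∈

  legalRev-remove : ∀ xs {v} ys → LegalRev G (xs ++ v ∷ ys) → LegalRev G (xs ++ ys)
  legalRev-remove []       ys (legal , _) = legal
  legalRev-remove (x ∷ xs) ys (legal , u , u∈N[x] , u-free) with before , _ ∷ after ← ++⁻ xs u-free =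
    legalRev-remove xs ys legal , u , u∈N[x] , ++⁺ before after

  Longest-reverse : ∀ {L} → Longest (LegalRev G) L → Longest (Legal G) (reverse L)
  Longest-reverse {L} (legal , max) =
    subst (LegalRev G) (≡.sym (reverse-involutive L)) legal , λ T legalT → begin
      length T           ≡⟨ ≡.sym (length-reverse T) ⟩
      length (reverse T) ≤⟨ max (reverse T) legalT ⟩
      length L           ≡⟨ ≡.sym (length-reverse L) ⟩
      length (reverse L) ∎
    where open ≤-Reasoning

  Simplicial : Fin n → Set
  Simplicial v = ∀ {y z} → Adj G v y → Adj G v z → y ∈N[ G ] z

  closed-neighbourhood⇒universal : Connected G → ∀ {v} → (∀ {y x} → Adj G v y → Adj G y x → x ∈N[ G ] v)
    → ∀ u → u ∈N[ G ] v
  closed-neighbourhood⇒universal conn {v} closed u = along (inj₁ refl) (conn v u)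
    where
    along : ∀ {c b} → c ∈N[ G ] v → Walk G c b → b ∈N[ G ] v
    along c∈N[v]     here           = c∈N[v]
    along (inj₁ refl) (step v~c′ w) = along (inj₂ v~c′) w
    along (inj₂ v~c) (step c~c′ w)  = along (closed v~c c~c′) w

  universal-simplicial⇒complete : ∀ {v} → (∀ u → u ∈N[ G ] v) → Simplicial v → ¬ NonComplete G
  universal-simplicial⇒complete universal simplicial (a , b , a≢b , a≁b) with universal a | universal b
  ... | inj₁ refl | inj₁ refl = a≢b refl
  ... | inj₁ refl | inj₂ a~b  = a≁b a~b
  ... | inj₂ v~a  | inj₁ refl = a≁b (sym G v~a)
  ... | inj₂ v~a  | inj₂ v~b  with simplicial v~b v~a
  ...   | inj₁ b≡a = a≢b (≡.sym b≡a)
  ...   | inj₂ a~b = a≁b a~b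

  simplicial-escape : Connected G → NonComplete G → ∀ {v} → Simplicial v
    → ∃[ y ] ∃[ x ] (Adj G v y × Adj G y x × ¬ x ∈N[ G ] v)
  simplicial-escape conn nc {v} simplicial
    with any? (λ y → adj? G v y ×-dec any? (λ x → adj? G y x ×-dec ¬? (x ∈N? v)))
  ... | yes (y , v~y , x , y~x , x∉N[v]) = y , x , v~y , y~x , x∉N[v]
  ... | no none = ⊥-elim (universal-simplicial⇒complete (closed-neighbourhood⇒universal conn closed) simplicial nc)
    where
    closed : ∀ {y x} → Adj G v y → Adj G y x → x ∈N[ G ] v
    closed {y} {x} v~y y~x = decidable-stable (x ∈N? v) λ x∉N[v] → none (y , v~y , x , y~x , x∉N[v])

  module _ (conn : Connected G) (nc : NonComplete G) {R : List (Fin n)} {v : Fin n}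
           (R-legal : LegalRev G R) (v-free : NotDominatedBy G R v)
           (saturated : ∀ a b → ¬ LegalRev G (a ∷ b ∷ R)) where

    private
      NeighboursAwayFromR : Set
      NeighboursAwayFromR = ∀ {y} → Adj G v y → ¬ Any (Adj G y) R

      neighbour-free : NeighboursAwayFromR → ∀ {u} → Adj G v u → NotDominatedBy G R u
      neighbour-free away {u} v~u = All.tabulate λ
        { w∈R (inj₁ refl) → All.lookup v-free w∈R (inj₂ (sym G v~u))
        ; w∈R (inj₂ w~u)  → away v~u (lose w∈R (sym G w~u)) }

      away⇒simplicial : NeighboursAwayFromR → Simplicial v
      away⇒simplicial away {y} {z} v~y v~z = decidable-stable (y ∈N? z) λ y∉N[z] →
        saturated v z ((R-legal , v , inj₂ (sym G v~z) , v-free) , y , inj₂ v~y , y∉N[z] ∷ neighbour-free away v~y)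

      away-extension : NeighboursAwayFromR → ∃[ z ] (Any (Adj G z) R × LegalRev G (z ∷ R))
      away-extension away with y , x , v~y , y~x , x∉N[v] ← simplicial-escape conn nc (away⇒simplicial away)
                          with anyᴸ? (x ∈N?_) R
      ... | no x-free = contradiction
              ((R-legal , v , inj₁ refl , v-free) , x , inj₂ y~x , x∉N[v] ∷ ¬Any⇒All¬ R x-free)
              (saturated y v)
      ... | yes x-dominated with find x-dominated
      ...   | w , w∈R , inj₁ refl = contradiction (lose w∈R y~x) (away v~y)
      ...   | w , w∈R , inj₂ w~x  = x , lose w∈R (sym G w~x) , R-legal , y , inj₂ (sym G y~x) , neighbour-free away v~y

    adjacent-extension : ∃[ z ] (Any (Adj G z) R × LegalRev G (z ∷ R))
    adjacent-extension with any? (λ z → adj? G v z ×-dec anyᴸ? (adj? G z) R)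
    ... | yes (z , v~z , z~R) = z , z~R , R-legal , v , inj₂ (sym G v~z) , v-free
    ... | no none = away-extension λ v~y y~R → none (_ , v~y , y~R)

  Isolated : List (Fin n) → Fin n → Set
  Isolated L x = x ∈ L × ¬ Any (Adj G x) L

  isolated? : ∀ L → Decidable (Isolated L)
  isolated? L x = anyᴸ? (x ≟ᶠ_) L ×-dec ¬? (anyᴸ? (adj? G x) L)

  isolatedCount : List (Fin n) → ℕ
  isolatedCount L = count (isolated? L) (allFin n)

  Isolated-resp-↭ : ∀ {L L′ x} → L ↭ L′ → Isolated L x → Isolated L′ x
  Isolated-resp-↭ L↭L′ (x∈L , x-iso) = ∈-resp-↭ L↭L′ x∈L , x-iso ∘ Any-resp-↭ (↭-sym L↭L′)

  Isolated-replace : ∀ {R v z x} → Any (Adj G z) R → Isolated (v ∷ R) v → Isolated (z ∷ R) x → Isolated (v ∷ R) x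
  Isolated-replace z~R _ (here refl , x-iso) = contradiction (there z~R) x-iso
  Isolated-replace z~R (_ , v-iso) (there x∈R , x-iso) = there x∈R , λ
    { (here x~v)  → v-iso (there (lose x∈R (sym G x~v)))
    ; (there x~R) → x-iso (there x~R) }

  isolatedCount-replace : ∀ {M R v z} → M ↭ v ∷ R → v ∉ R → Isolated M v → Any (Adj G z) R
    → isolatedCount (z ∷ R) < isolatedCount M
  isolatedCount-replace M↭ v∉R v-isolated z~R =
    count-< (isolated? _) (isolated? _)
      (Isolated-resp-↭ (↭-sym M↭) ∘ Isolated-replace z~R (Isolated-resp-↭ M↭ v-isolated))
      (∈-allFin _) v-isolated
      λ { (here refl , z-iso) → z-iso (there z~R) ; (there v∈R , _) → v∉R v∈R }

  replace-isolated : Connected G → NonComplete G → ∀ {M v} → Longest (LegalRev G) M → Isolated M v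
    → ∃[ M′ ] (Longest (LegalRev G) M′ × isolatedCount M′ < isolatedCount M)
  replace-isolated conn nc {v = v} (M-legal , M-max) v-isolated@(v∈M , v-iso) with xs , ys , refl ← ∈-∃++ v∈M =
    let z , z~R , z∷R-legal = adjacent-extension conn nc R-legal v-free saturated
    in z ∷ R , (z∷R-legal , λ K K-legal → subst (length K ≤_) |M| (M-max K K-legal))
             , isolatedCount-replace M↭ v∉R v-isolated z~R
    where
    R = xs ++ ys
    M↭ : xs ++ [ v ] ++ ys ↭ v ∷ R
    M↭ = shift v xs ys
    |M| : length (xs ++ [ v ] ++ ys) ≡ suc (length R)
    |M| = ↭-length M↭
    R-legal : LegalRev G R
    R-legal = legalRev-remove xs ys M-legal
    v∉R : v ∉ R
    v∉R = legalRev-∉-removed xs ys M-legal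
    v-free : NotDominatedBy G R v
    v-free = All.tabulate λ
      { w∈R (inj₁ refl) → v∉R w∈R
      ; w∈R (inj₂ w~v)  → v-iso (lose (∈-resp-↭ (↭-sym M↭) (there w∈R)) (sym G w~v)) }
    saturated : ∀ a b → ¬ LegalRev G (a ∷ b ∷ R)
    saturated a b legal = 1+n≰n (subst (suc (suc (length R)) ≤_) |M| (M-max (a ∷ b ∷ R) legal))

  longest-without-isolated : Connected G → NonComplete G → ∀ {L} → Acc _<_ (isolatedCount L)
    → Longest (LegalRev G) L → ∃[ S ] (Longest (LegalRev G) S × All (λ x → Any (Adj G x) S) S)
  longest-without-isolated conn nc {L} (acc smaller) longest with all? (λ x → anyᴸ? (adj? G x) L) L
  ... | yes none-isolated = L , longest , none-isolated
  ... | no some-isolated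
    with v , v∈L , v-iso ← find (¬All⇒Any¬ (λ x → anyᴸ? (adj? G x) L) L some-isolated)
    with L′ , longest′ , fewer ← replace-isolated conn nc longest (v∈L , v-iso)
    = longest-without-isolated conn nc (smaller fewer) longest′

-- HasEdge is redundant: a connected graph without edges has at most one vertex, so is complete.
theorem5p2 : ∀ (n : ℕ) (G : Graph n) → Connected G → NonComplete G → HasEdge G
    → ∃[ S ] (GrundyDominating G S × InducedNoIsolated G S)
theorem5p2 n G conn nc _ =
  let L , longest = longest-exists (legalRev? G) tt (legalRev-length≤ G)
      S , S-longest , S-no-isolated = longest-without-isolated G conn nc (<-wellFounded _) longest
  in reverse S , Longest-reverse G S-longest , λ v∈ →
       let w , w∈S , v~w = find (All.lookup S-no-isolated (reverse⁻ v∈)) in w , reverse⁺ w∈S , v~w
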